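{- If $G$ is a unicyclic graph whose unique cycle is a triangle $K_3$, then $\chi_i'(G)=\omega'(G)$ $(=3)$.
   Context: All graphs are finite and simple; a unicyclic graph is a connected graph with exactly one cycle. $\omega'(G)$ denotes the number of edges in a maximum clique of $G$. Three edges $e_1,e_2,e_3$ (in this order) are consecutive if $e_1=xy$, $e_2=yz$, $e_3=zu$ for some vertices $x,y,z,u$ (where $x=u$ is allowed). An injective edge coloring of $G$ is a map $c:E(G)\to\mathcal{C}$ such that whenever $e_1,e_2,e_3$ are consecutive edges, $c(e_1)\neq c(e_3)$. $\chi_i'(G)$ is the minimum number of colors in an injective edge coloring of $G$. -}

module Defs where

open import Data.Nat using (ℕ; zero; suc; _<_; _≤_)
open import Data.Nat.Combinatorics using (_C_)
open import Data.Fin using (Fin; zero; suc)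
open import Data.Bool using (Bool; T)
open import Data.List using (List; length)
open import Data.List.Relation.Unary.AllPairs using (AllPairs)
open import Data.Product using (Σ; ∃; _×_; _,_)
open import Data.Sum using (_⊎_)
open import Relation.Nullary using (¬_)
open import Relation.Binary.PropositionalEquality using (_≡_; _≢_)
open import Function using (Injective)

record Graph : Set where
  field
    n     : ℕ
    adj   : Fin n → Fin n → Bool
    sym   : ∀ x y → T (adj x y) → T (adj y x)
    irr   : ∀ x → ¬ T (adj x x)

module _ (G : Graph) where
  open Graph G

  V : Set
  V = Fin n

  Adj : V → V → Set
  Adj x y = T (adj x y)

  data Walk : V → V → Set where
    here : ∀ {x} → Walk x x
    step : ∀ {x y z} → Adj x y → Walk y z → Walk x z

  Connected : Set
  Connected = ∀ x y → Walk x y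

-- successor modulo (suc m) on Fin (suc m)
nextF : ∀ {m} → Fin (suc m) → Fin (suc m)
nextF {zero} zero = zero
nextF {suc m} zero = suc zero
nextF {suc m} (suc i) with nextF {m} i
... | zero  = zero
... | suc j = suc (suc j)

module _ (G : Graph) where
  open Graph G

  record Cycle : Set where
    field
      m     : ℕ                       -- length is suc m
      len≥3 : 3 ≤ suc m
      vert  : Fin (suc m) → V G
      inj   : Injective _≡_ _≡_ vert
      adjs  : ∀ i → Adj G (vert i) (vert (nextF i))

  cycleLength : Cycle → ℕ
  cycleLength Z = suc (Cycle.m Z)

  CycleEdge : Cycle → V G → V G → Set
  CycleEdge Z x y = ∃ λ i →
    (vert i ≡ x × vert (nextF i) ≡ y) ⊎ (vert i ≡ y × vert (nextF i) ≡ x)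
    where open Cycle Z

  SameCycle : Cycle → Cycle → Set
  SameCycle Z D = ∀ x y → (CycleEdge Z x y → CycleEdge D x y) × (CycleEdge D x y → CycleEdge Z x y)

  UnicyclicWith : Cycle → Set
  UnicyclicWith Z = Connected G × (∀ D → SameCycle Z D)

  record InjEdgeColoring (k : ℕ) : Set where
    field
      c       : V G → V G → Fin k
      c-sym   : ∀ x y → Adj G x y → c x y ≡ c y x
      -- consecutive edges xy, yz, zu (x = u allowed; the three edges are distinct)
      inj     : ∀ x y z u → Adj G x y → Adj G y z → Adj G z u →
                x ≢ z → y ≢ u → c x y ≢ c z u

  InjChromaticIndex : ℕ → Set
  InjChromaticIndex k = InjEdgeColoring k × (∀ j → j < k → ¬ InjEdgeColoring j)

  -- cliques: lists of pairwise adjacent (hence distinct) vertices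
  IsClique : List (V G) → Set
  IsClique = AllPairs (Adj G)

  CliqueEdgeNumber : ℕ → Set
  CliqueEdgeNumber e = Σ (List (V G)) λ K → IsClique K ×
    (∀ K' → IsClique K' → length K' ≤ length K) × (length K C 2 ≡ e)

module Submission where

-- Every cycle of G lies on T.  Measuring the distance d to T,
-- this forces G to be T with a tree hanging from each corner (Forest): a
-- vertex off T has exactly one neighbour closer to T, and no edge joins two
-- vertices at the same positive distance.  Both facts follow from one
-- observation (no-detour): if a vertex v ∉ T had two distinct neighbours
-- joined by a walk avoiding v, loop erasure would produce a cycle through v.
--
-- The triangle edge vᵢvⱼ gets the third index; an
-- edge from x down to a child gets a colour depending only on the corner
-- vₐ below x and on d x: next a at the corner, then rotating by one at each
-- further level.  Conversely, the three edges of T need three colours, and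
-- every clique with ≥ 3 vertices lies on T, so ω'(G) = 3.

open import Defs
open import Data.Nat using (ℕ; zero; suc; _≤_; _<_; z≤n; s≤s; _<?_) renaming (_≟_ to _≟ℕ_)
open import Data.Nat.Properties
  using (≤-antisym; ≤-trans; ≤-reflexive; ≤-pred; <-asym; <-cmp; n<1+n;
         n≤0⇒n≡0; m≤n⇒m≤1+n; 1+n≰n; 0≢1+n; suc-injective)
open import Data.Fin using (Fin; zero; suc; _≟_)
open import Data.Fin.Properties using (any?; all?; injective⇒≤)
open import Data.List using (List; []; _∷_; length; lookup)
open import Data.List.Membership.Propositional using (_∈_)
open import Data.List.Membership.Propositional.Properties using (∈-lookup)
open import Data.List.Relation.Unary.Any using (here; there)
open import Data.List.Relation.Unary.All as All using (All; []; _∷_)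
open import Data.List.Relation.Unary.All.Properties using (¬Any⇒All¬)
open import Data.List.Relation.Unary.AllPairs as AllPairs using ([]; _∷_)
open import Data.List.Relation.Unary.Linked using (Linked; []; [-]; _∷_)
open import Data.List.Relation.Unary.Unique.Propositional using (Unique)
open import Data.Product using (Σ; ∃; _×_; _,_; proj₂)
open import Data.Sum using (_⊎_; inj₁; inj₂)
open import Data.Empty using (⊥; ⊥-elim)
open import Function using (Injective; _∘′_)
open import Relation.Binary using (tri<; tri≈; tri>)
open import Relation.Binary.PropositionalEquality
  using (_≡_; _≢_; refl; sym; trans; cong; cong₂; subst; ≢-sym; module ≡-Reasoning)
open import Relation.Nullary using (¬_; Dec; yes; no)
open import Relation.Nullary.Decidable using (T?; from-yes; ¬?; _→-dec_; _×-dec_; _⊎-dec_)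
open import Relation.Unary using (Decidable)

-- Lists read as closed paths

lastOf : {A : Set} → A → List A → A
lastOf x []       = x
lastOf _ (y ∷ ys) = lastOf y ys

lookup-injective : {A : Set} {xs : List A} → Unique xs →
                   ∀ {i j} → lookup xs i ≡ lookup xs j → i ≡ j
lookup-injective {xs = _ ∷ _}  _              {zero}  {zero}  _  = refl
lookup-injective {xs = _ ∷ xs} (x≢xs ∷ _)     {zero}  {suc j} eq =
  ⊥-elim (All.lookup x≢xs (∈-lookup j) eq)
lookup-injective {xs = _ ∷ xs} (x≢xs ∷ _)     {suc i} {zero}  eq =
  ⊥-elim (All.lookup x≢xs (∈-lookup i) (sym eq))
lookup-injective {xs = _ ∷ _}  (_ ∷ distinct) {suc i} {suc j} eq =
  cong suc (lookup-injective distinct eq)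

module _ {A : Set} {R : A → A → Set} where

  -- The entry after position i of x ∷ xs, or the wrap-around value c
  -- when i is the last position.
  after : A → (x : A) (xs : List A) → Fin (suc (length xs)) → A
  after c x xs i with nextF i
  ... | zero  = c
  ... | suc j = lookup xs j

  after-linked : ∀ {c x xs} → Linked R (x ∷ xs) → R (lastOf x xs) c →
                 ∀ i → R (lookup (x ∷ xs) i) (after c x xs i)
  after-linked [-]      last zero = last
  after-linked (xy ∷ _) last zero = xy
  after-linked (_ ∷ linked) last (suc i)
    with nextF i | after-linked linked last i
  ... | zero  | rel = rel
  ... | suc _ | rel = rel

  after-self : ∀ x xs i → after x x xs i ≡ lookup (x ∷ xs) (nextF i)
  after-self x xs i with nextF i
  ... | zero  = refl
  ... | suc _ = refl

  cyclic-linked : ∀ {x xs} → Linked R (x ∷ xs) → R (lastOf x xs) x →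
                  ∀ i → R (lookup (x ∷ xs) i) (lookup (x ∷ xs) (nextF i))
  cyclic-linked {x} {xs} linked last i =
    subst (R (lookup (x ∷ xs) i)) (after-self x xs i) (after-linked linked last i)

-- Walks, loop erasure and cycles

module Walks (G : Graph) where
  open import Data.List.Membership.DecPropositional (_≟_ {Graph.n G}) using (_∈?_)

  adj-sym : ∀ {x y} → Adj G x y → Adj G y x
  adj-sym {x} {y} = Graph.sym G x y

  adj⇒≢ : ∀ {x y} → Adj G x y → x ≢ y
  adj⇒≢ {x} xx refl = Graph.irr G x xx

  data WalkIn (P : V G → Set) : V G → V G → Set where
    halt : ∀ {x} → P x → WalkIn P x x
    hop  : ∀ {x y z} → P x → Adj G x y → WalkIn P y z → WalkIn P x z

  module _ {P : V G → Set} where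

    first : ∀ {x y} → WalkIn P x y → P x
    first (halt px)    = px
    first (hop px _ _) = px

    _++ʷ_ : ∀ {x y z} → WalkIn P x y → WalkIn P y z → WalkIn P x z
    halt _       ++ʷ w′ = w′
    hop px xy w  ++ʷ w′ = hop px xy (w ++ʷ w′)

    reverseʷ : ∀ {x y} → WalkIn P x y → WalkIn P y x
    reverseʷ (halt px)     = halt px
    reverseʷ (hop px xy w) = reverseʷ w ++ʷ hop (first w) (adj-sym xy) (halt px)

    mapʷ : ∀ {Q : V G → Set} {x y} → (∀ {v} → P v → Q v) → WalkIn P x y → WalkIn Q x y
    mapʷ f (halt px)     = halt (f px)
    mapʷ f (hop px xy w) = hop (f px) xy (mapʷ f w)

    record SimplePath (x y : V G) : Set where
      constructor path
      field
        rest   : List (V G)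
        linked : Linked (Adj G) (x ∷ rest)
        unique : Unique (x ∷ rest)
        inside : All P (x ∷ rest)
        ends   : lastOf x rest ≡ y

    drop-to : ∀ {x y z} (p : SimplePath y z) → x ∈ y ∷ SimplePath.rest p → SimplePath x z
    drop-to p (here refl) = p
    drop-to (path (_ ∷ rest) (_ ∷ l) (_ ∷ u) (_ ∷ i) e) (there x∈) =
      drop-to (path rest l u i e) x∈

    erase : ∀ {x y} → WalkIn P x y → SimplePath x y
    erase (halt px) = path [] [-] ([] ∷ []) (px ∷ []) refl
    erase {x} (hop {y = y} px xy w) with erase w
    ... | p@(path rest l u i e) with x ∈? (y ∷ rest)
    ...   | yes x∈ = drop-to p x∈
    ...   | no x∉  = path (y ∷ rest) (xy ∷ l) (¬Any⇒All¬ _ x∉ ∷ u) (px ∷ i) e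

  close-up : ∀ x xs → Linked (Adj G) (x ∷ xs) → Unique (x ∷ xs) →
             Adj G (lastOf x xs) x → 2 ≤ length xs → Cycle G
  close-up x xs linked distinct last long = record
    { m = length xs ; len≥3 = s≤s long ; vert = lookup (x ∷ xs)
    ; inj = lookup-injective distinct ; adjs = cyclic-linked linked last }

  detour-cycle : ∀ {v p q} → Adj G v p → Adj G q v → p ≢ q → WalkIn (v ≢_) p q →
                 Σ (Cycle G) λ D → Cycle.vert D zero ≡ v
  detour-cycle {v} {p} vp qv p≢q w with erase w
  ... | path [] _ _ _ p≡q = ⊥-elim (p≢q p≡q)
  ... | path (b ∷ rest) linked distinct avoids ends =
    close-up v (p ∷ b ∷ rest) (vp ∷ linked) (avoids ∷ distinct)
      (subst (λ z → Adj G z v) (sym ends) qv) (s≤s (s≤s z≤n)) , refl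

  triangle-cycle : ∀ {a b c} → Adj G a b → Adj G b c → Adj G c a →
                   Σ (Cycle G) λ D → Cycle.vert D zero ≡ a
  triangle-cycle ab bc ca =
    close-up _ (_ ∷ _ ∷ []) (ab ∷ bc ∷ [-])
      ((adj⇒≢ ab ∷ adj⇒≢ (adj-sym ca) ∷ []) ∷ (adj⇒≢ bc ∷ []) ∷ [] ∷ [])
      ca (s≤s (s≤s z≤n)) , refl

on-the-cycle : (G : Graph) (Z : Cycle G) → UnicyclicWith G Z →
               ∀ (D : Cycle G) j → ∃ λ i → Cycle.vert Z i ≡ Cycle.vert D j
on-the-cycle G Z (_ , same) D j with proj₂ (same D _ _) (j , inj₁ (refl , refl))
... | i , inj₁ (onZ , _) = i , onZ
... | i , inj₂ (_ , onZ) = nextF i , onZ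

-- Distance to a decidable vertex set

module Search where

  least : {P : ℕ → Set} → (∀ k → Dec (P k)) → ℕ → ℕ
  least P? zero = zero
  least P? (suc b) with P? zero
  ... | yes _ = zero
  ... | no  _ = suc (least (λ k → P? (suc k)) b)

  least-satisfies : {P : ℕ → Set} (P? : ∀ k → Dec (P k)) (b : ℕ) → P b → P (least P? b)
  least-satisfies P? zero    pb = pb
  least-satisfies P? (suc b) pb with P? zero
  ... | yes p0 = p0
  ... | no  _  = least-satisfies (λ k → P? (suc k)) b pb

  least-minimal : {P : ℕ → Set} (P? : ∀ k → Dec (P k)) (b k : ℕ) → P k → least P? b ≤ k
  least-minimal P? zero    k       _  = z≤n
  least-minimal P? (suc b) k       pk with P? zero
  least-minimal P? (suc b) k       pk | yes _ = z≤n
  least-minimal P? (suc b) zero    pk | no ¬p0 = ⊥-elim (¬p0 pk)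
  least-minimal P? (suc b) (suc k) pk | no _ = s≤s (least-minimal (λ k → P? (suc k)) b k pk)

module Distance (G : Graph) (conn : Connected G)
                (S : V G → Set) (S? : Decidable S) {s₀ : V G} (s₀∈S : S s₀) where
  open Walks G
  open Search

  adj? : ∀ x y → Dec (Adj G x y)
  adj? x y = T? (Graph.adj G x y)

  Near : ℕ → V G → Set
  Near zero    v = S v
  Near (suc k) v = S v ⊎ ∃ λ w → Adj G v w × Near k w

  near? : ∀ k v → Dec (Near k v)
  near? zero    v = S? v
  near? (suc k) v = S? v ⊎-dec any? (λ w → adj? v w ×-dec near? k w)

  walk-length : ∀ {x y} → Walk G x y → ℕ
  walk-length here       = zero
  walk-length (step _ w) = suc (walk-length w)

  walk-near : ∀ {v t} (w : Walk G v t) → S t → Near (walk-length w) v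
  walk-near here       t∈S = t∈S
  walk-near (step a w) t∈S = inj₂ (_ , a , walk-near w t∈S)

  -- The distance from v to S; connectivity supplies a bound for the search.
  bound : V G → ℕ
  bound v = walk-length (conn v s₀)

  d : V G → ℕ
  d v = least (λ k → near? k v) (bound v)

  d-near : ∀ v → Near (d v) v
  d-near v = least-satisfies (λ k → near? k v) (bound v) (walk-near (conn v s₀) s₀∈S)

  d-minimal : ∀ {v} k → Near k v → d v ≤ k
  d-minimal {v} = least-minimal (λ k → near? k v) (bound v)

  S⇒d≡0 : ∀ {v} → S v → d v ≡ 0
  S⇒d≡0 v∈S = n≤0⇒n≡0 (d-minimal 0 v∈S)

  d≡0⇒S : ∀ {v} → d v ≡ 0 → S v
  d≡0⇒S {v} e = subst (λ k → Near k v) e (d-near v)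

  positive⇒∉S : ∀ {v k} → d v ≡ suc k → ¬ S v
  positive⇒∉S e v∈S = 0≢1+n (trans (sym (S⇒d≡0 v∈S)) e)

  d-adj : ∀ {v w} → Adj G v w → d v ≤ suc (d w)
  d-adj {v} {w} vw = d-minimal (suc (d w)) (inj₂ (w , vw , d-near w))

  d-descend : ∀ {v k} → d v ≡ suc k → ∃ λ w → Adj G v w × d w ≡ k
  d-descend {v} e with subst (λ j → Near j v) e (d-near v)
  ... | inj₁ v∈S = ⊥-elim (positive⇒∉S e v∈S)
  ... | inj₂ (w , vw , near) =
    w , vw , ≤-antisym (d-minimal _ near) (≤-pred (subst (_≤ suc (d w)) e (d-adj vw)))

  descend : ∀ {k} v → d v ≡ k → ∃ λ s → S s × WalkIn (λ z → d z ≤ k) v s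
  descend {zero}  v e = v , d≡0⇒S e , halt (≤-reflexive e)
  descend {suc k} v e with d-descend e
  ... | w , vw , ew with descend w ew
  ...   | s , s∈S , down = s , s∈S , hop (≤-reflexive e) vw (mapʷ m≤n⇒m≤1+n down)

  above : ∀ {v k z} → d v ≡ suc k → d z ≤ k → v ≢ z
  above {k = k} e z≤k refl = 1+n≰n (subst (_≤ k) e z≤k)

-- When all cycles lie in a connected set S, G is S with trees attached

module Forest (G : Graph) (conn : Connected G)
              (S : V G → Set) (S? : Decidable S) {s₀ : V G} (s₀∈S : S s₀)
              (S-connected : ∀ {s t} → S s → S t → Walks.WalkIn G S s t)
              (cycles-in-S : ∀ (D : Cycle G) i → S (Cycle.vert D i)) where
  open Walks G
  open Distance G conn S S? s₀∈S public

  no-detour : ∀ {v p q} → ¬ S v → Adj G v p → Adj G v q → p ≢ q →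
              WalkIn (v ≢_) p q → ⊥
  no-detour v∉S vp vq p≢q w with detour-cycle vp (adj-sym vq) p≢q w
  ... | D , refl = v∉S (cycles-in-S D zero)

  -- Any two vertices of depth ≤ k are joined by a walk of depth ≤ k (via S).
  low-walk : ∀ {p q k} → d p ≤ k → d q ≤ k → WalkIn (λ z → d z ≤ k) p q
  low-walk {p} {q} p≤k q≤k with descend p refl | descend q refl
  ... | s , s∈S , ps | t , t∈S , qt =
    mapʷ (λ z≤ → ≤-trans z≤ p≤k) ps
      ++ʷ (mapʷ (λ z∈S → subst (_≤ _) (sym (S⇒d≡0 z∈S)) z≤n) (S-connected s∈S t∈S)
      ++ʷ reverseʷ (mapʷ (λ z≤ → ≤-trans z≤ q≤k) qt))

  lower-neighbours-equal : ∀ {v p q} → Adj G v p → Adj G v q →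
                           d v ≡ suc (d p) → d v ≡ suc (d q) → p ≡ q
  lower-neighbours-equal {v} {p} {q} vp vq ep eq with p ≟ q
  ... | yes p≡q = p≡q
  ... | no  p≢q = ⊥-elim (no-detour (positive⇒∉S ep) vp vq p≢q
                    (mapʷ (above ep) (low-walk (≤-reflexive refl) q≤p)))
    where
      q≤p : d q ≤ d p
      q≤p = ≤-reflexive (suc-injective (trans (sym eq) ep))

  no-level-edge : ∀ {x y k} → Adj G x y → d x ≡ suc k → d y ≡ suc k → ⊥
  no-level-edge xy ex ey with d-descend ex | d-descend ey
  ... | p , xp , ep | q , yq , eq =
    no-detour (positive⇒∉S ex) xp xy (≢-sym (above ey (≤-reflexive ep)))
      (mapʷ (above ex) (low-walk (≤-reflexive ep) (≤-reflexive eq))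
        ++ʷ hop (above ex (≤-reflexive eq)) (adj-sym yq) (halt (adj⇒≢ xy)))

  same-depth : ∀ {x y} → Adj G x y → ∀ k → d x ≡ k → d y ≡ k → S x × S y
  same-depth xy zero    ex ey = d≡0⇒S ex , d≡0⇒S ey
  same-depth xy (suc k) ex ey = ⊥-elim (no-level-edge xy ex ey)

  data EdgeKind (x y : V G) : Set where
    inside : S x → S y → EdgeKind x y
    down   : d y ≡ suc (d x) → EdgeKind x y
    up     : d x ≡ suc (d y) → EdgeKind x y

  edge-kind : ∀ {x y} → Adj G x y → EdgeKind x y
  edge-kind {x} {y} xy with <-cmp (d x) (d y)
  ... | tri< x<y _ _ = down (≤-antisym (d-adj (adj-sym xy)) x<y)
  ... | tri> _ _ y<x = up (≤-antisym (d-adj xy) y<x)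
  ... | tri≈ _ x≡y _ with same-depth xy (d x) refl (sym x≡y)
  ...   | x∈S , y∈S = inside x∈S y∈S

  -- The neighbour one step closer to S (or the vertex itself on S).
  parent : V G → V G
  parent v with any? (λ w → adj? v w ×-dec (suc (d w) ≟ℕ d v))
  ... | yes (w , _) = w
  ... | no  _       = v

  parent-spec : ∀ {v k} → d v ≡ suc k → Adj G v (parent v) × d (parent v) ≡ k
  parent-spec {v} e with any? (λ w → adj? v w ×-dec (suc (d w) ≟ℕ d v))
  ... | yes (w , vw , ew) = vw , suc-injective (trans ew e)
  ... | no  none with d-descend e
  ...   | w , vw , ew = ⊥-elim (none (w , vw , trans (cong suc ew) (sym e)))

  parent-of : ∀ {x y} → Adj G x y → d y ≡ suc (d x) → parent y ≡ x
  parent-of xy e with parent-spec e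
  ... | y-par , d-par =
    lower-neighbours-equal y-par (adj-sym xy) (trans e (cong suc (sym d-par))) e

  iterate-parent : ℕ → V G → V G
  iterate-parent zero    v = v
  iterate-parent (suc k) v = iterate-parent k (parent v)

  root : V G → V G
  root v = iterate-parent (d v) v

  root-of-S : ∀ {v} → S v → root v ≡ v
  root-of-S {v} v∈S = cong (λ k → iterate-parent k v) (S⇒d≡0 v∈S)

  root-down : ∀ {x y} → Adj G x y → d y ≡ suc (d x) → root y ≡ root x
  root-down {x} {y} xy e = begin
    iterate-parent (d y) y          ≡⟨ cong (λ k → iterate-parent k y) e ⟩
    iterate-parent (d x) (parent y) ≡⟨ cong (iterate-parent (d x)) (parent-of xy e) ⟩
    iterate-parent (d x) x          ∎
    where open ≡-Reasoning

-- Colours: facts about Fin 3, each checked by exhaustion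

rot : Fin 3 → Fin 3
rot zero             = suc (suc zero)
rot (suc zero)       = zero
rot (suc (suc zero)) = suc zero

next : Fin 3 → Fin 3
next c = rot (rot c)

-- For distinct i, j: the remaining element of Fin 3.
third : Fin 3 → Fin 3 → Fin 3
third zero             (suc zero)       = suc (suc zero)
third (suc zero)       zero             = suc (suc zero)
third zero             (suc (suc zero)) = suc zero
third (suc (suc zero)) zero             = suc zero
third _                _                = zero

rot-≢ : ∀ c → rot c ≢ c
rot-≢ = from-yes (all? λ c → ¬? (rot c ≟ c))

next-≢ : ∀ c → next c ≢ c
next-≢ = from-yes (all? λ c → ¬? (next c ≟ c))

rot-next : ∀ c → rot (next c) ≡ c
rot-next = from-yes (all? λ c → rot (next c) ≟ c)

next-injective : ∀ a b → next a ≡ next b → a ≡ b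
next-injective = from-yes (all? λ a → all? λ b → next a ≟ next b →-dec a ≟ b)

third-sym : ∀ i j → third i j ≡ third j i
third-sym = from-yes (all? λ i → all? λ j → third i j ≟ third j i)

third-≢ʳ : ∀ i j → i ≢ j → third i j ≢ j
third-≢ʳ = from-yes (all? λ i → all? λ j → ¬? (i ≟ j) →-dec ¬? (third i j ≟ j))

third-unique : ∀ i j k → i ≢ j → k ≢ i → k ≢ j → third i j ≡ k
third-unique = from-yes (all? λ i → all? λ j → all? λ k →
  ¬? (i ≟ j) →-dec ¬? (k ≟ i) →-dec ¬? (k ≟ j) →-dec third i j ≟ k)

-- Colours met at the two ends of the triangle edge vⱼvₖ are disjoint
-- (see `corner` below).
corners-differ : ∀ {j k c c′} → j ≢ k → c ≡ k ⊎ c ≡ next j → c′ ≡ j ⊎ c′ ≡ next k → c ≢ c′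
corners-differ j≢k (inj₁ refl) (inj₁ refl) = ≢-sym j≢k
corners-differ j≢k (inj₁ refl) (inj₂ refl) = ≢-sym (next-≢ _)
corners-differ j≢k (inj₂ refl) (inj₁ refl) = next-≢ _
corners-differ j≢k (inj₂ refl) (inj₂ refl) = j≢k ∘′ next-injective _ _

three-distinct : ∀ {k} (a b c : Fin k) → b ≢ a → c ≢ b → a ≢ c → 3 ≤ k
three-distinct a b c b≢a c≢b a≢c = injective⇒≤ {f = pick} pick-injective
  where
    pick : Fin 3 → Fin _
    pick zero             = a
    pick (suc zero)       = b
    pick (suc (suc zero)) = c

    pick-injective : Injective _≡_ _≡_ pick
    pick-injective {zero}           {zero}           _ = refl
    pick-injective {zero}           {suc zero}       e = ⊥-elim (b≢a (sym e))
    pick-injective {zero}           {suc (suc zero)} e = ⊥-elim (a≢c e)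
    pick-injective {suc zero}       {zero}           e = ⊥-elim (b≢a e)
    pick-injective {suc zero}       {suc zero}       _ = refl
    pick-injective {suc zero}       {suc (suc zero)} e = ⊥-elim (c≢b (sym e))
    pick-injective {suc (suc zero)} {zero}           e = ⊥-elim (a≢c (sym e))
    pick-injective {suc (suc zero)} {suc zero}       e = ⊥-elim (c≢b e)
    pick-injective {suc (suc zero)} {suc (suc zero)} _ = refl

-- The triangle case

module Triangle (G : Graph) (conn : Connected G) (vt : Fin 3 → V G)
                (vt-inj : Injective _≡_ _≡_ vt)
                (vt-adj : ∀ i → Adj G (vt i) (vt (nextF i)))
                (cycles-on-T : ∀ (D : Cycle G) j → ∃ λ i → vt i ≡ Cycle.vert D j) where
  open Walks G

  OnT : V G → Set
  OnT v = ∃ λ i → vt i ≡ v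

  onT? : Decidable OnT
  onT? v = any? (λ i → vt i ≟ v)

  vt-≢ : ∀ {i j x y} → vt i ≡ x → vt j ≡ y → x ≢ y → i ≢ j
  vt-≢ refl refl x≢y i≡j = x≢y (cong vt i≡j)

  triangle-adj : ∀ i j → i ≢ j → Adj G (vt i) (vt j)
  triangle-adj zero             zero             i≢j = ⊥-elim (i≢j refl)
  triangle-adj zero             (suc zero)       _   = vt-adj zero
  triangle-adj zero             (suc (suc zero)) _   = adj-sym (vt-adj (suc (suc zero)))
  triangle-adj (suc zero)       zero             _   = adj-sym (vt-adj zero)
  triangle-adj (suc zero)       (suc zero)       i≢j = ⊥-elim (i≢j refl)
  triangle-adj (suc zero)       (suc (suc zero)) _   = vt-adj (suc zero)
  triangle-adj (suc (suc zero)) zero             _   = vt-adj (suc (suc zero))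
  triangle-adj (suc (suc zero)) (suc zero)       _   = adj-sym (vt-adj (suc zero))
  triangle-adj (suc (suc zero)) (suc (suc zero)) i≢j = ⊥-elim (i≢j refl)

  -- T is connected through itself, so the Forest structure applies.
  T-connected : ∀ {s t} → OnT s → OnT t → WalkIn OnT s t
  T-connected (i , refl) (j , refl) with i ≟ j
  ... | yes refl = halt (i , refl)
  ... | no  i≢j  = hop (i , refl) (triangle-adj i j i≢j) (halt (j , refl))

  open Forest G conn OnT onT? (zero , refl) T-connected cycles-on-T

  -- The corner index of a vertex on T (arbitrary elsewhere).
  index : V G → Fin 3
  index v with onT? v
  ... | yes (i , _) = i
  ... | no  _       = zero

  index-vt : ∀ {i v} → vt i ≡ v → index v ≡ i
  index-vt {i} {v} e with onT? v
  ... | yes (j , e′) = vt-inj (trans e′ (sym e))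
  ... | no  v∉T      = ⊥-elim (v∉T (i , e))

  -- Colour of an edge from a vertex at depth k down to a child, in the
  -- tree hanging from the corner vₐ.
  tree-colour : Fin 3 → ℕ → Fin 3
  tree-colour a zero    = next a
  tree-colour a (suc k) = rot (tree-colour a k)

  down-colour : V G → Fin 3
  down-colour x = tree-colour (index (root x)) (d x)

  colour : V G → V G → Fin 3
  colour x y with onT? x ×-dec onT? y
  ... | yes ((i , _) , (j , _)) = third i j
  ... | no  _ with d x <? d y
  ...   | yes _ = down-colour x
  ...   | no  _ = down-colour y

  colour-inside : ∀ {i j x y} → vt i ≡ x → vt j ≡ y → colour x y ≡ third i j
  colour-inside {i} {j} {x} {y} ex ey with onT? x ×-dec onT? y
  ... | yes ((i′ , ex′) , (j′ , ey′)) =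
    cong₂ third (vt-inj (trans ex′ (sym ex))) (vt-inj (trans ey′ (sym ey)))
  ... | no  ¬both = ⊥-elim (¬both ((i , ex) , (j , ey)))

  colour-down : ∀ {x y} → d y ≡ suc (d x) → colour x y ≡ down-colour x
  colour-down {x} {y} e with onT? x ×-dec onT? y
  ... | yes (_ , y∈T) = ⊥-elim (positive⇒∉S e y∈T)
  ... | no  _ with d x <? d y
  ...   | yes _  = refl
  ...   | no  x≮y = ⊥-elim (x≮y (≤-reflexive (sym e)))

  colour-up : ∀ {x y} → d x ≡ suc (d y) → colour x y ≡ down-colour y
  colour-up {x} {y} e with onT? x ×-dec onT? y
  ... | yes (x∈T , _) = ⊥-elim (positive⇒∉S e x∈T)
  ... | no  _ with d x <? d y
  ...   | yes x<y = ⊥-elim (<-asym x<y (subst (d y <_) (sym e) (n<1+n (d y))))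
  ...   | no  _   = refl

  colour-sym : ∀ {x y} → Adj G x y → colour x y ≡ colour y x
  colour-sym xy with edge-kind xy
  ... | inside (i , ex) (j , ey) =
    trans (colour-inside ex ey) (trans (third-sym i j) (sym (colour-inside ey ex)))
  ... | down e = trans (colour-down e) (sym (colour-up e))
  ... | up   e = trans (colour-up e) (sym (colour-down e))

  down-colour-corner : ∀ {j x} → vt j ≡ x → down-colour x ≡ next j
  down-colour-corner {j} ex = trans
    (cong₂ (λ r k → tree-colour (index r) k) (root-of-S (j , ex)) (S⇒d≡0 (j , ex)))
    (cong next (index-vt ex))

  down-colour-child : ∀ {x y} → Adj G x y → d y ≡ suc (d x) → down-colour y ≡ rot (down-colour x)
  down-colour-child xy e = cong₂ (λ r k → tree-colour (index r) k) (root-down xy e) e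

  down-middle : ∀ {x y z u} → Adj G x y → Adj G y z → Adj G z u → y ≢ u →
                d z ≡ suc (d y) → colour x y ≢ colour z u
  down-middle {x} {y} {z} {u} xy yz zu y≢u ez with edge-kind zu
  ... | inside z∈T _ = ⊥-elim (positive⇒∉S ez z∈T)
  ... | up eu = ⊥-elim (y≢u (lower-neighbours-equal (adj-sym yz) zu ez eu))
  ... | down eu = from-xy (edge-kind xy)
    where
      open ≡-Reasoning
      zu-colour : colour z u ≡ rot (down-colour y)
      zu-colour = trans (colour-down eu) (down-colour-child yz ez)

      from-xy : EdgeKind x y → colour x y ≢ colour z u
      from-xy (inside (i , ex) (j , ey)) same =
        third-≢ʳ i j (vt-≢ ex ey (adj⇒≢ xy)) (begin
          third i j            ≡⟨ sym (colour-inside ex ey) ⟩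
          colour x y           ≡⟨ same ⟩
          colour z u           ≡⟨ zu-colour ⟩
          rot (down-colour y)  ≡⟨ cong rot (down-colour-corner ey) ⟩
          rot (next j)         ≡⟨ rot-next j ⟩
          j                    ∎)
      from-xy (down ey) same = next-≢ (down-colour x) (begin
          rot (rot (down-colour x)) ≡⟨ cong rot (sym (down-colour-child xy ey)) ⟩
          rot (down-colour y)       ≡⟨ sym zu-colour ⟩
          colour z u                ≡⟨ sym same ⟩
          colour x y                ≡⟨ colour-down ey ⟩
          down-colour x             ∎)
      from-xy (up ex) same = rot-≢ (down-colour y) (begin
          rot (down-colour y) ≡⟨ sym zu-colour ⟩
          colour z u          ≡⟨ sym same ⟩
          colour x y          ≡⟨ colour-up ex ⟩
          down-colour y       ∎)

  -- An edge at the corner vⱼ not reaching the corner vₖ has colour k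
  -- (a triangle edge) or next j (an edge down into vⱼ's tree).
  corner : ∀ {j k x} → Adj G x (vt j) → j ≢ k → x ≢ vt k →
           colour x (vt j) ≡ k ⊎ colour x (vt j) ≡ next j
  corner {j} {k} xy j≢k x≢vk with edge-kind xy
  ... | inside (i , ex) _ = inj₁ (trans (colour-inside ex refl)
          (third-unique i j k (vt-≢ ex refl (adj⇒≢ xy))
            (λ k≡i → x≢vk (trans (sym ex) (cong vt (sym k≡i)))) (≢-sym j≢k)))
  ... | down e = ⊥-elim (0≢1+n (trans (sym (S⇒d≡0 (j , refl))) e))
  ... | up e = inj₂ (trans (colour-up e) (down-colour-corner refl))

  triangle-middle : ∀ {x j k u} → Adj G x (vt j) → Adj G (vt k) u → j ≢ k →
                    x ≢ vt k → vt j ≢ u → colour x (vt j) ≢ colour (vt k) u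
  triangle-middle xy zu j≢k x≢z y≢u same =
    corners-differ j≢k (corner xy j≢k x≢z)
      (corner (adj-sym zu) (≢-sym j≢k) (≢-sym y≢u))
      (trans same (colour-sym zu))

  -- Injectivity, by the kind of the middle edge (an up edge is a down
  -- edge read backwards).
  colour-injective : ∀ x y z u → Adj G x y → Adj G y z → Adj G z u →
                     x ≢ z → y ≢ u → colour x y ≢ colour z u
  colour-injective x y z u xy yz zu x≢z y≢u with edge-kind yz
  ... | down e = down-middle xy yz zu y≢u e
  ... | up e = λ same → down-middle (adj-sym zu) (adj-sym yz) (adj-sym xy) (≢-sym x≢z) e
                 (trans (sym (colour-sym zu)) (trans (sym same) (colour-sym xy)))
  ... | inside (j , refl) (k , refl) =
    triangle-middle xy zu (vt-≢ refl refl (adj⇒≢ yz)) x≢z y≢u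

  colouring : InjEdgeColoring G 3
  colouring = record
    { c = colour ; c-sym = λ _ _ → colour-sym ; inj = colour-injective }

  -- The three edges of T are pairwise consecutive, so need three colours.
  no-fewer-colours : ∀ k → k < 3 → ¬ InjEdgeColoring G k
  no-fewer-colours k k<3 C = 1+n≰n (≤-trans k<3 (three-distinct
      (c v₀ v₁) (c v₁ v₂) (c v₂ v₀)
      (inj v₁ v₂ v₀ v₁ e₁ e₂ e₀ (distinct (λ ())) (distinct (λ ())))
      (inj v₂ v₀ v₁ v₂ e₂ e₀ e₁ (distinct (λ ())) (distinct (λ ())))
      (inj v₀ v₁ v₂ v₀ e₀ e₁ e₂ (distinct (λ ())) (distinct (λ ())))))
    where
      open InjEdgeColoring C
      v₀ v₁ v₂ : V G
      v₀ = vt zero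
      v₁ = vt (suc zero)
      v₂ = vt (suc (suc zero))
      e₀ : Adj G v₀ v₁
      e₀ = vt-adj zero
      e₁ : Adj G v₁ v₂
      e₁ = vt-adj (suc zero)
      e₂ : Adj G v₂ v₀
      e₂ = vt-adj (suc (suc zero))
      distinct : ∀ {i j} → i ≢ j → vt i ≢ vt j
      distinct i≢j e = i≢j (vt-inj e)

  triangle-on-T : ∀ {a b c} → Adj G a b → Adj G b c → Adj G c a → OnT a
  triangle-on-T ab bc ca with triangle-cycle ab bc ca
  ... | D , refl = cycles-on-T D zero

  clique-on-T : ∀ {a b c} rest → IsClique G (a ∷ b ∷ c ∷ rest) → All OnT (a ∷ b ∷ c ∷ rest)
  clique-on-T rest ((ab ∷ ac ∷ a-rest) ∷ (bc ∷ b-rest) ∷ _) =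
    triangle-on-T ab bc (adj-sym ac) ∷ triangle-on-T bc (adj-sym ac) ab
      ∷ triangle-on-T (adj-sym ac) ab bc
      ∷ All.zipWith (λ (ax , bx) → triangle-on-T (adj-sym ax) ab bx) (a-rest , b-rest)

  onT-index : ∀ {v} → OnT v → vt (index v) ≡ v
  onT-index (i , e) = trans (cong vt (index-vt e)) e

  -- A clique on T has at most three vertices: the corner index is injective.
  clique-size : ∀ K → IsClique G K → All OnT K → length K ≤ 3
  clique-size K clique onT = injective⇒≤ {f = λ i → index (lookup K i)} index-injective
    where
      index-injective : Injective _≡_ _≡_ (λ i → index (lookup K i))
      index-injective {i} {j} e = lookup-injective (AllPairs.map adj⇒≢ clique) (begin
        lookup K i               ≡⟨ sym (onT-index (All.lookup onT (∈-lookup i))) ⟩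
        vt (index (lookup K i))  ≡⟨ cong vt e ⟩
        vt (index (lookup K j))  ≡⟨ onT-index (All.lookup onT (∈-lookup j)) ⟩
        lookup K j               ∎)
        where open ≡-Reasoning

  maximum-clique : ∀ K → IsClique G K → length K ≤ 3
  maximum-clique []                    _      = z≤n
  maximum-clique (_ ∷ [])              _      = s≤s z≤n
  maximum-clique (_ ∷ _ ∷ [])          _      = s≤s (s≤s z≤n)
  maximum-clique K@(_ ∷ _ ∷ _ ∷ rest)  clique = clique-size K clique (clique-on-T rest clique)

  clique-number : CliqueEdgeNumber G 3
  clique-number =
    (vt zero ∷ vt (suc zero) ∷ vt (suc (suc zero)) ∷ []) ,
    ((vt-adj zero ∷ adj-sym (vt-adj (suc (suc zero))) ∷ []) ∷ (vt-adj (suc zero) ∷ []) ∷ [] ∷ []) ,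
    maximum-clique , refl

proposition7 : (G : Graph) (Z : Cycle G) → UnicyclicWith G Z → cycleLength G Z ≡ 3 →
    InjChromaticIndex G 3 × CliqueEdgeNumber G 3
proposition7 G Z@(record { vert = vt ; inj = vt-inj ; adjs = vt-adj }) unicyclic@(conn , _) refl =
  (colouring , no-fewer-colours) , clique-number
  where open Triangle G conn vt vt-inj vt-adj (on-the-cycle G Z unicyclic)
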